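{- Let $q=nv+1$ be a prime power (with $n,v$ positive integers) and let $k>2$. Assume that there exists a cyclic $(R_{q,v},k,1)$ difference family all of whose base blocks are zero-sum in $\mathbb{F}_q$. Then there exists an $\mathrm{EA}(q)$-additive $(v,k,1)$-design.
   Context: A $(v,k,1)$-design is a pair $(V,\mathcal{B})$ with $V$ a $v$-set and $\mathcal{B}$ a collection of $k$-subsets of $V$ such that every pair of distinct points lies in exactly one block ($v>k>2$). $\mathrm{EA}(q)$ is the elementary abelian group of order $q$, i.e. the additive group of $\mathbb{F}_q$. A design is $\mathrm{EA}(q)$-additive if, up to isomorphism, its points are elements of $\mathrm{EA}(q)$ and every block sums to $0$. For $q\equiv 1 \pmod{m}$, $R_{q,m}$ is the subgroup of order $m$ of the multiplicative group $\mathbb{F}_q^*$ (the $m$-th roots of unity). For a multiplicative group $G$ and a set $\mathcal{F}$ of subsets of $G$, the list of differences $\Delta\mathcal{F}$ is the multiset of all ratios $xy^{ -1}$ with $(x,y)$ an ordered pair of distinct elements of the same member of $\mathcal{F}$. For a subgroup $H$ of $G$, a $(G,H,k,1)$ difference family is a set of $k$-subsets of $G$ (base blocks) whose list of differences is exactly $G\setminus H$ (each element once). A cyclic $(G,k,1)$ difference family is a $(G,H,k,1)$ difference family where $G$ is cyclic of order $v\equiv 1$ or $k \pmod{k(k-1)}$ and $H$ is the subgroup of $G$ of order $1$ or $k$, respectively. -}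

module Defs where

open import Level using (0ℓ)
open import Data.Nat as ℕ using (ℕ; zero; suc; _%_; _<_)
open import Data.List using (List; []; _∷_; length; concatMap; foldr; filter)
open import Data.List.Membership.Propositional using (_∈_)
open import Data.List.Relation.Unary.All using (All)
open import Data.List.Relation.Unary.Unique.Propositional using (Unique)
open import Data.Product using (_×_; Σ; ∃)
open import Relation.Nullary using (¬_; Dec; yes; no)
open import Relation.Binary.PropositionalEquality using (_≡_; _≢_)
open import Algebra.Structures using (IsCommutativeRing)
import Data.Sum
import Data.List.Membership.DecPropositional

-- A finite field with q elements, with propositional equality.
-- Multiplicative inverse is total with inv 0# = 0# (convention); only
-- x * inv x ≡ 1# for x ≢ 0# is required.
record FiniteField (q : ℕ) : Set₁ where
  infixl 7 _*_
  infixl 6 _+_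
  field
    Carrier  : Set
    _≟_      : (x y : Carrier) → Dec (x ≡ y)
    _+_ _*_  : Carrier → Carrier → Carrier
    -_       : Carrier → Carrier
    0# 1#    : Carrier
    isCommutativeRing : IsCommutativeRing _≡_ _+_ _*_ -_ 0# 1#
    0≢1      : 0# ≢ 1#
    inv      : Carrier → Carrier
    inv-zero : inv 0# ≡ 0#
    *-inv    : ∀ x → x ≢ 0# → x * inv x ≡ 1#
    elements : List Carrier
    elements-unique   : Unique elements
    elements-complete : ∀ x → x ∈ elements
    card     : length elements ≡ q

module _ {q : ℕ} (F : FiniteField q) where
  open FiniteField F

  pow : Carrier → ℕ → Carrier
  pow x zero    = 1#
  pow x (suc n) = x * pow x n

  -- R_{q,m}: the m-th roots of unity (the subgroup of order m of F_q^*)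
  R : ℕ → Carrier → Set
  R m x = pow x m ≡ 1#

  count : Carrier → List Carrier → ℕ
  count g []       = 0
  count g (x ∷ xs) with g ≟ x
  ... | yes _ = suc (count g xs)
  ... | no  _ = count g xs

  sumF : List Carrier → Carrier
  sumF = foldr _+_ 0#

  ΔBlock : List Carrier → List Carrier
  ΔBlock b = concatMap (λ x → concatMap (λ y → diff x y) b) b
    where
    diff : Carrier → Carrier → List Carrier
    diff x y with x ≟ y
    ... | yes _ = []
    ... | no  _ = x * inv y ∷ []

  Δ : List (List Carrier) → List Carrier
  Δ = concatMap ΔBlock

  IsKSubsetOf : (Carrier → Set) → ℕ → List Carrier → Set
  IsKSubsetOf S k b = length b ≡ k × Unique b × All S b

  IsDF : (G H : Carrier → Set) → ℕ → List (List Carrier) → Set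
  IsDF G H k ℱ =
    All (IsKSubsetOf G k) ℱ ×
    (∀ g → (G g × ¬ H g → count g (Δ ℱ) ≡ 1) ×
           (¬ (G g × ¬ H g) → count g (Δ ℱ) ≡ 0))

  -- cyclic (R_{q,v}, k, 1) difference family: H is the subgroup of
  -- R_{q,v} of order 1 (if v ≡ 1 mod k(k-1)) or of order k, i.e. R_{q,k}
  -- (if v ≡ k mod k(k-1)).
  IsCyclicDF : (v k : ℕ) → List (List Carrier) → Set
  IsCyclicDF v k ℱ =
    (∃ (λ t → v ≡ 1 ℕ.+ t ℕ.* (k ℕ.* (k ℕ.∸ 1))) × IsDF (R v) (λ x → x ≡ 1#) k ℱ)
    Data.Sum.⊎
    (∃ (λ t → v ≡ k ℕ.+ t ℕ.* (k ℕ.* (k ℕ.∸ 1))) × IsDF (R v) (λ x → R v x × R k x) k ℱ)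

  ZeroSum : List Carrier → Set
  ZeroSum b = sumF b ≡ 0#

  countBlocks : Carrier → Carrier → List (List Carrier) → ℕ
  countBlocks x y [] = 0
  countBlocks x y (b ∷ bs) with Data.List.Membership.DecPropositional._∈?_ _≟_ x b
                               | Data.List.Membership.DecPropositional._∈?_ _≟_ y b
  ... | yes _ | yes _ = suc (countBlocks x y bs)
  ... | _     | _     = countBlocks x y bs

  IsDesign : (v k : ℕ) → List Carrier → List (List Carrier) → Set
  IsDesign v k V ℬ =
    2 < k × k < v ×
    length V ≡ v × Unique V ×
    All (IsKSubsetOf (_∈ V) k) ℬ ×
    (∀ x y → x ∈ V → y ∈ V → x ≢ y → countBlocks x y ℬ ≡ 1)

  -- EA(q)-additive (v,k,1)-design: points in F, every block sums to 0
  AdditiveDesign : (v k : ℕ) → Set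
  AdditiveDesign v k =
    Σ (List Carrier) λ V → Σ (List (List Carrier)) λ ℬ →
      IsDesign v k V ℬ × All ZeroSum ℬ

-- Let V = R_{q,v}; as v divides q − 1, V has exactly v elements. Developing a base block B,
-- i.e. taking the blocks r·B for r ∈ V, gives zero-sum blocks, and the number of them that
-- contain two points x ≠ y of V is the multiplicity of x·y⁻¹ in ΔB. Hence the developments of
-- the family cover exactly once each pair {x, y} with x·y⁻¹ ∉ H, and no other pair. If H is
-- trivial this is the design. If H = R_{q,k}, the uncovered pairs are those lying in a common
-- coset of R_{q,k} in V, so the cosets are added as blocks; each sums to zero because
-- multiplication by any h ≠ 1 in R_{q,k} permutes it.

module Submission where

open import Defs
open import Level using (0ℓ)
open import Algebra.Bundles using (CommutativeRing; CommutativeMonoid)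
import Algebra.Properties.CommutativeSemigroup as CommutativeSemigroupProperties
open import Data.Maybe using (nothing)
open import Data.Nat as ℕ using (ℕ; zero; suc; _≤_; _<_; z≤n; s≤s)
import Data.Nat.Properties as ℕ
open import Data.Nat.ListAction using (sum)
open import Data.Nat.Tactic.RingSolver as ℕ-Solver using ()
open import Data.List using (List; []; _∷_; _++_; foldr; length; map; filter; replicate; concatMap)
open import Data.List.Properties
  using (length-map; length-replicate; length-++; filter-++; filter-none; filter-≐; map-cong; map-cong-local; concatMap-pure)
open import Data.List.Membership.Propositional using (_∈_)
open import Data.List.Membership.Propositional.Properties using (∈-filter⁺; ∈-filter⁻; ∈-map⁺; ∈-map⁻)
open import Data.List.Membership.Propositional.Properties.WithK using (unique∧set⇒bag)
import Data.List.Membership.DecPropositional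
open import Data.List.Relation.Binary.BagAndSetEquality using (∼bag⇒↭)
open import Data.List.Relation.Binary.Permutation.Propositional using (_↭_; ↭⇒↭ₛ)
open import Data.List.Relation.Binary.Permutation.Propositional.Properties using (↭-length)
open import Data.List.Relation.Binary.Permutation.Setoid.Properties using (foldr-commMonoid)
open import Data.List.Relation.Unary.All as All using (All; []; _∷_)
import Data.List.Relation.Unary.All.Properties as All
open import Data.List.Relation.Unary.Any using (here; there)
open import Data.List.Relation.Unary.Unique.Propositional using (Unique; []; _∷_)
import Data.List.Relation.Unary.Unique.Propositional.Properties as Unique
open import Data.Product using (Σ; _×_; _,_; proj₁; proj₂; ∃)
open import Data.Sum using (inj₁; inj₂)
open import Function using (case_of_)
open import Function.Bundles using (mk⇔)
open import Relation.Binary.Definitions using (DecidableEquality)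
open import Relation.Binary.PropositionalEquality
  using (_≡_; _≢_; refl; sym; trans; cong; cong₂; subst; setoid; module ≡-Reasoning)
open import Relation.Nullary using (Dec; yes; no; ¬?; contradiction)
open import Relation.Nullary.Decidable using (decidable-stable; _×-dec_)
open import Relation.Unary using (Pred; Decidable; _≐_)
open import Tactic.RingSolver using (solve-∀)
open import Tactic.RingSolver.Core.AlmostCommutativeRing using (AlmostCommutativeRing; fromCommutativeRing)

-- Counting in lists

indicator : ∀ {p} {P : Set p} → Dec P → ℕ
indicator (yes _) = 1
indicator (no _)  = 0

unique-same-members⇒↭ : {A : Set} {xs ys : List A} → Unique xs → Unique ys →
  (∀ {z} → z ∈ xs → z ∈ ys) → (∀ {z} → z ∈ ys → z ∈ xs) → xs ↭ ys
unique-same-members⇒↭ uxs uys to from = ∼bag⇒↭ (unique∧set⇒bag uxs uys (mk⇔ to from))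

length-unique-same-members : {A : Set} {xs ys : List A} → Unique xs → Unique ys →
  (∀ {z} → z ∈ xs → z ∈ ys) → (∀ {z} → z ∈ ys → z ∈ xs) → length xs ≡ length ys
length-unique-same-members uxs uys to from = ↭-length (unique-same-members⇒↭ uxs uys to from)

module _ {A : Set} where

  open import Data.Nat using (_+_; _*_)
  open CommutativeSemigroupProperties ℕ.+-commutativeSemigroup using () renaming (interchange to +-interchange)

  length-injective-image : {B : Set} (f : A → B) → (∀ {x y} → f x ≡ f y → x ≡ y) → {xs : List A} {ys : List B} →
    Unique xs → Unique ys →
    (∀ {z} → z ∈ map f xs → z ∈ ys) → (∀ {z} → z ∈ ys → z ∈ map f xs) → length xs ≡ length ys
  length-injective-image f f-inj {xs} uxs uys to from =
    trans (sym (length-map f xs)) (length-unique-same-members (Unique.map⁺ f-inj uxs) uys to from)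

  length-filter≡sum : {P : Pred A 0ℓ} (P? : Decidable P) (xs : List A) →
    length (filter P? xs) ≡ sum (map (λ x → indicator (P? x)) xs)
  length-filter≡sum P? []       = refl
  length-filter≡sum P? (x ∷ xs) with P? x
  ... | yes _ = cong suc (length-filter≡sum P? xs)
  ... | no  _ = length-filter≡sum P? xs

  length-filter-map : {B : Set} {P : Pred B 0ℓ} (P? : Decidable P) (f : A → B) (xs : List A) →
    length (filter P? (map f xs)) ≡ length (filter (λ x → P? (f x)) xs)
  length-filter-map P? f []       = refl
  length-filter-map P? f (x ∷ xs) with P? (f x)
  ... | yes _ = cong suc (length-filter-map P? f xs)
  ... | no  _ = length-filter-map P? f xs

  length-filter-concatMap : {B : Set} {P : Pred B 0ℓ} (P? : Decidable P) (f : A → List B) (xs : List A) →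
    length (filter P? (concatMap f xs)) ≡ sum (map (λ x → length (filter P? (f x))) xs)
  length-filter-concatMap P? f []       = refl
  length-filter-concatMap P? f (x ∷ xs) = begin
    length (filter P? (f x ++ concatMap f xs))
      ≡⟨ cong length (filter-++ P? (f x) (concatMap f xs)) ⟩
    length (filter P? (f x) ++ filter P? (concatMap f xs))
      ≡⟨ length-++ (filter P? (f x)) ⟩
    length (filter P? (f x)) + length (filter P? (concatMap f xs))
      ≡⟨ cong (length (filter P? (f x)) +_) (length-filter-concatMap P? f xs) ⟩
    length (filter P? (f x)) + sum (map (λ x → length (filter P? (f x))) xs) ∎
    where open ≡-Reasoning

  sum-map-+ : (f g : A → ℕ) (xs : List A) →
    sum (map (λ x → f x + g x) xs) ≡ sum (map f xs) + sum (map g xs)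
  sum-map-+ f g []       = refl
  sum-map-+ f g (x ∷ xs) = begin
    f x + g x + sum (map (λ x → f x + g x) xs)    ≡⟨ cong (f x + g x +_) (sum-map-+ f g xs) ⟩
    f x + g x + (sum (map f xs) + sum (map g xs)) ≡⟨ +-interchange (f x) (g x) _ _ ⟩
    f x + sum (map f xs) + (g x + sum (map g xs)) ∎
    where open ≡-Reasoning

  sum-map-zero : (xs : List A) → sum (map (λ _ → 0) xs) ≡ 0
  sum-map-zero []       = refl
  sum-map-zero (_ ∷ xs) = sum-map-zero xs

  sum-map-≤ : (f : A → ℕ) (m : ℕ) → (∀ x → f x ≤ m) → (xs : List A) → sum (map f xs) ≤ length xs * m
  sum-map-≤ f m f≤m []       = z≤n
  sum-map-≤ f m f≤m (x ∷ xs) = ℕ.+-mono-≤ (f≤m x) (sum-map-≤ f m f≤m xs)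

  module _ (_≟_ : DecidableEquality A) where

    length-filter-≟-unique : {x : A} {xs : List A} → Unique xs → x ∈ xs → length (filter (x ≟_) xs) ≡ 1
    length-filter-≟-unique {x} {xs} uxs x∈xs =
      length-unique-same-members (Unique.filter⁺ (x ≟_) uxs) ([] ∷ [])
        (λ z∈ → here (sym (proj₂ (∈-filter⁻ (x ≟_) {xs = xs} z∈))))
        (λ { (here refl) → ∈-filter⁺ (x ≟_) x∈xs refl })

    sum-indicator-≟-unique : {x : A} {xs : List A} → Unique xs → x ∈ xs →
      sum (map (λ y → indicator (x ≟ y)) xs) ≡ 1
    sum-indicator-≟-unique {x} {xs} uxs x∈xs =
      trans (sym (length-filter≡sum (x ≟_) xs)) (length-filter-≟-unique uxs x∈xs)

    length≡sum-fibres : {B : Set} (f : B → A) {ys : List A} → Unique ys → (xs : List B) →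
      All (λ x → f x ∈ ys) xs → length xs ≡ sum (map (λ y → length (filter (λ x → f x ≟ y) xs)) ys)
    length≡sum-fibres f {ys} uys [] [] = sym (sum-map-zero ys)
    length≡sum-fibres {B} f {ys} uys (x ∷ xs) (fx∈ys ∷ fxs∈ys) = begin
      suc (length xs)
        ≡⟨ cong (_+ length xs) (sum-indicator-≟-unique uys fx∈ys) ⟨
      sum (map (λ y → indicator (f x ≟ y)) ys) + length xs
        ≡⟨ cong (sum (map (λ y → indicator (f x ≟ y)) ys) +_) (length≡sum-fibres f uys xs fxs∈ys) ⟩
      sum (map (λ y → indicator (f x ≟ y)) ys) + sum (map (fibre xs) ys)
        ≡⟨ sum-map-+ _ _ ys ⟨
      sum (map (λ y → indicator (f x ≟ y) + fibre xs y) ys)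
        ≡⟨ cong sum (map-cong fibre-cons ys) ⟩
      sum (map (fibre (x ∷ xs)) ys) ∎
      where
      open ≡-Reasoning
      fibre : List B → A → ℕ
      fibre zs y = length (filter (λ z → f z ≟ y) zs)
      fibre-cons : ∀ y → indicator (f x ≟ y) + fibre xs y ≡ fibre (x ∷ xs) y
      fibre-cons y with f x ≟ y
      ... | yes _ = refl
      ... | no  _ = refl

    ∃-≢ : ∀ {xs : List A} → Unique xs → 2 ≤ length xs → ∀ z → ∃ λ h → h ∈ xs × h ≢ z
    ∃-≢ {a ∷ b ∷ _} ((a≢b ∷ _) ∷ _) _        z with a ≟ z
    ... | yes refl = b , there (here refl) , λ b≡a → a≢b (sym b≡a)
    ... | no  a≢z  = a , here refl , a≢z
    ∃-≢ {_ ∷ []} _ (s≤s ()) _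

-- Arithmetic in a finite field

module _ {q : ℕ} (F : FiniteField q) where

  open FiniteField F hiding (_+_; _*_; -_; 0#; 1#)
  open Data.List.Membership.DecPropositional _≟_ using (_∈?_)

  commutativeRing : CommutativeRing 0ℓ 0ℓ
  commutativeRing = record { isCommutativeRing = isCommutativeRing }

  ring : AlmostCommutativeRing 0ℓ 0ℓ
  ring = fromCommutativeRing commutativeRing (λ _ → nothing)

  -- The operations are those of `ring`, so that the ring solver recognises them.
  open AlmostCommutativeRing ring using (_+_; _*_; -_; 0#; 1#)

  open CommutativeRing commutativeRing
    using (*-comm; *-assoc; *-identityˡ; *-identityʳ; zeroˡ; zeroʳ; distribˡ; +-identityˡ; +-identityʳ; -‿inverseˡ;
           +-commutativeMonoid; *-commutativeMonoid)
  open CommutativeSemigroupProperties (CommutativeRing.*-commutativeSemigroup commutativeRing)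
    using () renaming (interchange to *-interchange)

  *-inverseˡ : ∀ x → x ≢ 0# → inv x * x ≡ 1#
  *-inverseˡ x x≢0 = trans (*-comm (inv x) x) (*-inv x x≢0)

  x*[x⁻¹*y]≡y : ∀ {x} y → x ≢ 0# → x * (inv x * y) ≡ y
  x*[x⁻¹*y]≡y {x} y x≢0 = begin
    x * (inv x * y) ≡⟨ *-assoc x (inv x) y ⟨
    x * inv x * y   ≡⟨ cong (_* y) (*-inv x x≢0) ⟩
    1# * y          ≡⟨ *-identityˡ y ⟩
    y               ∎
    where open ≡-Reasoning

  x⁻¹*[x*y]≡y : ∀ {x} y → x ≢ 0# → inv x * (x * y) ≡ y
  x⁻¹*[x*y]≡y {x} y x≢0 = begin
    inv x * (x * y) ≡⟨ *-assoc (inv x) x y ⟨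
    inv x * x * y   ≡⟨ cong (_* y) (*-inverseˡ x x≢0) ⟩
    1# * y          ≡⟨ *-identityˡ y ⟩
    y               ∎
    where open ≡-Reasoning

  x*y⁻¹*y≡x : ∀ x {y} → y ≢ 0# → x * inv y * y ≡ x
  x*y⁻¹*y≡x x {y} y≢0 = trans (*-assoc x (inv y) y) (trans (cong (x *_) (*-inverseˡ y y≢0)) (*-identityʳ x))

  x*y*y⁻¹≡x : ∀ x {y} → y ≢ 0# → x * y * inv y ≡ x
  x*y*y⁻¹≡x x {y} y≢0 = trans (*-assoc x y (inv y)) (trans (cong (x *_) (*-inv y y≢0)) (*-identityʳ x))

  x*[y*x⁻¹]≡y : ∀ {x} y → x ≢ 0# → x * (y * inv x) ≡ y
  x*[y*x⁻¹]≡y {x} y x≢0 = trans (cong (x *_) (*-comm y (inv x))) (x*[x⁻¹*y]≡y y x≢0)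

  *-cancelˡ : ∀ {x a b} → x ≢ 0# → x * a ≡ x * b → a ≡ b
  *-cancelˡ {x} {a} {b} x≢0 xa≡xb =
    trans (sym (x⁻¹*[x*y]≡y a x≢0)) (trans (cong (inv x *_) xa≡xb) (x⁻¹*[x*y]≡y b x≢0))

  *-cancelʳ : ∀ {x a b} → x ≢ 0# → a * x ≡ b * x → a ≡ b
  *-cancelʳ {x} {a} {b} x≢0 ax≡bx = *-cancelˡ x≢0 (trans (*-comm x a) (trans ax≡bx (*-comm b x)))

  *-nonzero : ∀ {x y} → x ≢ 0# → y ≢ 0# → x * y ≢ 0#
  *-nonzero {x} {y} x≢0 y≢0 xy≡0 = y≢0 (*-cancelˡ x≢0 (trans xy≡0 (sym (zeroʳ x))))

  *≡1⇒≡inv : ∀ {x y} → x * y ≡ 1# → y ≡ inv x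
  *≡1⇒≡inv {x} {y} xy≡1 = *-cancelˡ x≢0 (trans xy≡1 (sym (*-inv x x≢0)))
    where
    x≢0 : x ≢ 0#
    x≢0 x≡0 = 0≢1 (trans (sym (zeroˡ y)) (trans (cong (_* y) (sym x≡0)) xy≡1))

  inv-nonzero : ∀ {x} → x ≢ 0# → inv x ≢ 0#
  inv-nonzero {x} x≢0 x⁻¹≡0 = 0≢1 (trans (sym (zeroʳ x)) (trans (cong (x *_) (sym x⁻¹≡0)) (*-inv x x≢0)))

  inv-involutive : ∀ {x} → x ≢ 0# → inv (inv x) ≡ x
  inv-involutive {x} x≢0 = sym (*≡1⇒≡inv (*-inverseˡ x x≢0))

  -- inv 0# ≡ 0# makes inv injective on the whole field.
  inv-injective : ∀ {x y} → inv x ≡ inv y → x ≡ y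
  inv-injective {x} {y} x⁻¹≡y⁻¹ with x ≟ 0# | y ≟ 0#
  ... | yes x≡0 | yes y≡0 = trans x≡0 (sym y≡0)
  ... | yes refl | no y≢0 = contradiction (trans (sym x⁻¹≡y⁻¹) inv-zero) (inv-nonzero y≢0)
  ... | no x≢0 | yes refl = contradiction (trans x⁻¹≡y⁻¹ inv-zero) (inv-nonzero x≢0)
  ... | no x≢0 | no y≢0 = trans (sym (inv-involutive x≢0)) (trans (cong inv x⁻¹≡y⁻¹) (inv-involutive y≢0))

  inv-distrib-* : ∀ {x y} → x ≢ 0# → y ≢ 0# → inv (x * y) ≡ inv x * inv y
  inv-distrib-* {x} {y} x≢0 y≢0 = sym (*≡1⇒≡inv (begin
    x * y * (inv x * inv y) ≡⟨ *-interchange x y (inv x) (inv y) ⟩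
    x * inv x * (y * inv y) ≡⟨ cong₂ _*_ (*-inv x x≢0) (*-inv y y≢0) ⟩
    1# * 1#                 ≡⟨ *-identityˡ 1# ⟩
    1#                      ∎))
    where open ≡-Reasoning

  inv-*-inv : ∀ {x y} → x ≢ 0# → y ≢ 0# → inv (x * inv y) ≡ y * inv x
  inv-*-inv {x} {y} x≢0 y≢0 = begin
    inv (x * inv y)     ≡⟨ inv-distrib-* x≢0 (inv-nonzero y≢0) ⟩
    inv x * inv (inv y) ≡⟨ cong (inv x *_) (inv-involutive y≢0) ⟩
    inv x * y           ≡⟨ *-comm (inv x) y ⟩
    y * inv x           ∎
    where open ≡-Reasoning

  ≡*inv⇒*inv≡ : ∀ {a c g} → a ≢ 0# → c ≢ 0# → g ≡ a * inv c → a * inv g ≡ c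
  ≡*inv⇒*inv≡ {a} {c} a≢0 c≢0 refl = trans (cong (a *_) (inv-*-inv a≢0 c≢0)) (x*[y*x⁻¹]≡y c a≢0)

  sumF-map-* : ∀ x ys → sumF F (map (x *_) ys) ≡ x * sumF F ys
  sumF-map-* x []       = sym (zeroʳ x)
  sumF-map-* x (y ∷ ys) = trans (cong (x * y +_) (sumF-map-* x ys)) (sym (distribˡ x y (sumF F ys)))

  pow-distrib-* : ∀ x y n → pow F (x * y) n ≡ pow F x n * pow F y n
  pow-distrib-* x y zero    = sym (*-identityˡ 1#)
  pow-distrib-* x y (suc n) = trans (cong (x * y *_) (pow-distrib-* x y n)) (*-interchange x y (pow F x n) (pow F y n))

  pow-+ : ∀ x m n → pow F x (m ℕ.+ n) ≡ pow F x m * pow F x n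
  pow-+ x zero    n = sym (*-identityˡ _)
  pow-+ x (suc m) n = trans (cong (x *_) (pow-+ x m n)) (sym (*-assoc x (pow F x m) (pow F x n)))

  pow-1# : ∀ n → pow F 1# n ≡ 1#
  pow-1# zero    = refl
  pow-1# (suc n) = trans (*-identityˡ _) (pow-1# n)

  pow-* : ∀ x m n → pow F x (m ℕ.* n) ≡ pow F (pow F x m) n
  pow-* x m zero    rewrite ℕ.*-zeroʳ m = refl
  pow-* x m (suc n) rewrite ℕ.*-suc m n = trans (pow-+ x m (m ℕ.* n)) (cong (pow F x m *_) (pow-* x m n))

  pow-inv*pow : ∀ {x} n → x ≢ 0# → pow F (inv x) n * pow F x n ≡ 1#
  pow-inv*pow {x} n x≢0 = trans (sym (pow-distrib-* (inv x) x n)) (trans (cong (λ y → pow F y n) (*-inverseˡ x x≢0)) (pow-1# n))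

  R⇒nonzero : ∀ {n} .{{_ : ℕ.NonZero n}} {x} → R F n x → x ≢ 0#
  R⇒nonzero {suc n} R-x refl = 0≢1 (trans (sym (zeroˡ _)) R-x)

  R-* : ∀ {n x y} → R F n x → R F n y → R F n (x * y)
  R-* {n} {x} {y} R-x R-y = trans (pow-distrib-* x y n) (trans (cong₂ _*_ R-x R-y) (*-identityˡ 1#))

  R-inv : ∀ {n x} → x ≢ 0# → R F n x → R F n (inv x)
  R-inv {n} {x} x≢0 R-x = trans (sym (*-identityʳ _)) (trans (cong (pow F (inv x) n *_) (sym R-x)) (pow-inv*pow n x≢0))

  R-divisor : ∀ {d n x} → R F d x → R F (d ℕ.* n) x
  R-divisor {d} {n} {x} R-x = trans (pow-* x d n) (trans (cong (λ y → pow F y n) R-x) (pow-1# n))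

  pow≡⇒R-*inv : ∀ k {x y} → y ≢ 0# → pow F x k ≡ pow F y k → R F k (x * inv y)
  pow≡⇒R-*inv k {x} {y} y≢0 xᵏ≡yᵏ = begin
    pow F (x * inv y) k           ≡⟨ pow-distrib-* x (inv y) k ⟩
    pow F x k * pow F (inv y) k   ≡⟨ cong (_* pow F (inv y) k) xᵏ≡yᵏ ⟩
    pow F y k * pow F (inv y) k   ≡⟨ *-comm _ _ ⟩
    pow F (inv y) k * pow F y k   ≡⟨ pow-inv*pow k y≢0 ⟩
    1#                            ∎
    where open ≡-Reasoning

  R-*inv⇒pow≡ : ∀ k {x y} → y ≢ 0# → R F k (x * inv y) → pow F x k ≡ pow F y k
  R-*inv⇒pow≡ k {x} {y} y≢0 R-xy⁻¹ = begin
    pow F x k                     ≡⟨ cong (λ z → pow F z k) (x*y⁻¹*y≡x x y≢0) ⟨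
    pow F (x * inv y * y) k       ≡⟨ pow-distrib-* (x * inv y) y k ⟩
    pow F (x * inv y) k * pow F y k ≡⟨ cong (_* pow F y k) R-xy⁻¹ ⟩
    1# * pow F y k                ≡⟨ *-identityˡ _ ⟩
    pow F y k                     ∎
    where open ≡-Reasoning

  sumF-↭ : ∀ {xs ys} → xs ↭ ys → sumF F xs ≡ sumF F ys
  sumF-↭ xs↭ys = foldr-commMonoid (setoid Carrier) (CommutativeMonoid.isCommutativeMonoid +-commutativeMonoid) (↭⇒↭ₛ xs↭ys)

  product : List Carrier → Carrier
  product = foldr _*_ 1#

  product-↭ : ∀ {xs ys} → xs ↭ ys → product xs ≡ product ys
  product-↭ xs↭ys = foldr-commMonoid (setoid Carrier) (CommutativeMonoid.isCommutativeMonoid *-commutativeMonoid) (↭⇒↭ₛ xs↭ys)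

  -- Roots of polynomials and roots of unity

  -- [c₀, …, c_{d-1}] represents the monic polynomial c₀ + c₁X + ⋯ + c_{d-1}X^{d-1} + X^d.
  evalMonic : List Carrier → Carrier → Carrier
  evalMonic []       x = 1#
  evalMonic (c ∷ cs) x = c + x * evalMonic cs x

  -- Synthetic division by X − r.
  divideMonic : List Carrier → Carrier → List Carrier
  divideMonic []            r = []
  divideMonic (c ∷ [])      r = []
  divideMonic (c ∷ c′ ∷ cs) r = evalMonic (c′ ∷ cs) r ∷ divideMonic (c′ ∷ cs) r

  length-divideMonic : ∀ c cs r → length (divideMonic (c ∷ cs) r) ≡ length cs
  length-divideMonic c []        r = refl
  length-divideMonic c (c′ ∷ cs) r = cong suc (length-divideMonic c′ cs r)

  -- p(x) − p(r) = (x − r) · (p ÷ (X − r))(x), with both subtractions moved across.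
  divideMonic-correct : ∀ c cs r x →
    evalMonic (c ∷ cs) x + r * evalMonic (divideMonic (c ∷ cs) r) x ≡
    x * evalMonic (divideMonic (c ∷ cs) r) x + evalMonic (c ∷ cs) r
  divideMonic-correct c []        r x = base c r x
    where
    base : ∀ c r x → c + x * 1# + r * 1# ≡ x * 1# + (c + r * 1#)
    base = solve-∀ ring
  divideMonic-correct c (c′ ∷ cs) r x = begin
    c + x * P + r * (s + x * Q) ≡⟨ regroup c x P r s Q ⟩
    c + r * s + x * (P + r * Q) ≡⟨ cong (λ y → c + r * s + x * y) (divideMonic-correct c′ cs r x) ⟩
    c + r * s + x * (x * Q + s) ≡⟨ finish c x Q r s ⟩
    x * (s + x * Q) + (c + r * s) ∎
    where
    open ≡-Reasoning
    P = evalMonic (c′ ∷ cs) x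
    s = evalMonic (c′ ∷ cs) r
    Q = evalMonic (divideMonic (c′ ∷ cs) r) x
    regroup : ∀ c x P r s Q → c + x * P + r * (s + x * Q) ≡ c + r * s + x * (P + r * Q)
    regroup = solve-∀ ring
    finish : ∀ c x Q r s → c + r * s + x * (x * Q + s) ≡ x * (s + x * Q) + (c + r * s)
    finish = solve-∀ ring

  divideMonic-root : ∀ c cs {r z} → evalMonic (c ∷ cs) r ≡ 0# → evalMonic (c ∷ cs) z ≡ 0# → r ≢ z →
    evalMonic (divideMonic (c ∷ cs) r) z ≡ 0#
  divideMonic-root c cs {r} {z} p[r]≡0 p[z]≡0 r≢z = decidable-stable (Q ≟ 0#) λ Q≢0 → r≢z (*-cancelʳ Q≢0 (begin
    r * Q                            ≡⟨ +-identityˡ (r * Q) ⟨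
    0# + r * Q                       ≡⟨ cong (_+ r * Q) p[z]≡0 ⟨
    evalMonic (c ∷ cs) z + r * Q     ≡⟨ divideMonic-correct c cs r z ⟩
    z * Q + evalMonic (c ∷ cs) r     ≡⟨ cong (z * Q +_) p[r]≡0 ⟩
    z * Q + 0#                       ≡⟨ +-identityʳ (z * Q) ⟩
    z * Q                            ∎))
    where
    open ≡-Reasoning
    Q = evalMonic (divideMonic (c ∷ cs) r) z

  length-roots≤degree : ∀ cs {xs} → Unique xs → All (λ x → evalMonic cs x ≡ 0#) xs → length xs ≤ length cs
  length-roots≤degree cs       {[]}     _ _ = z≤n
  length-roots≤degree []       {r ∷ xs} _ (1≡0 ∷ _) = contradiction (sym 1≡0) 0≢1
  length-roots≤degree (c ∷ cs) {r ∷ xs} (r∉xs ∷ uxs) (p[r]≡0 ∷ p[xs]≡0) =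
    subst (length xs <_) (cong suc (length-divideMonic c cs r))
      (s≤s (length-roots≤degree (divideMonic (c ∷ cs) r) uxs
        (All.zipWith (λ (r≢z , p[z]≡0) → divideMonic-root c cs p[r]≡0 p[z]≡0 r≢z) (r∉xs , p[xs]≡0))))

  evalMonic-replicate-0# : ∀ n x → evalMonic (replicate n 0#) x ≡ pow F x n
  evalMonic-replicate-0# zero    x = refl
  evalMonic-replicate-0# (suc n) x = trans (+-identityˡ _) (cong (x *_) (evalMonic-replicate-0# n x))

  length-roots-pow≤ : ∀ n a {xs} → Unique xs → All (λ x → pow F x (suc n) ≡ a) xs → length xs ≤ suc n
  length-roots-pow≤ n a {xs} uxs xs-roots =
    subst (length xs ≤_) (cong suc (length-replicate n))
      (length-roots≤degree (- a ∷ replicate n 0#) uxs (All.map root xs-roots))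
    where
    root : ∀ {x} → pow F x (suc n) ≡ a → evalMonic (- a ∷ replicate n 0#) x ≡ 0#
    root {x} xⁿ⁺¹≡a = trans (cong (λ y → - a + x * y) (evalMonic-replicate-0# n x))
                            (trans (cong (- a +_) xⁿ⁺¹≡a) (-‿inverseˡ a))

  units : List Carrier
  units = filter (λ x → ¬? (x ≟ 0#)) elements

  units-unique : Unique units
  units-unique = Unique.filter⁺ (λ x → ¬? (x ≟ 0#)) elements-unique

  ∈-units⁺ : ∀ {x} → x ≢ 0# → x ∈ units
  ∈-units⁺ {x} x≢0 = ∈-filter⁺ (λ x → ¬? (x ≟ 0#)) (elements-complete x) x≢0

  ∈-units⁻ : ∀ {x} → x ∈ units → x ≢ 0#
  ∈-units⁻ x∈units = proj₂ (∈-filter⁻ (λ x → ¬? (x ≟ 0#)) {xs = elements} x∈units)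

  suc-length-units : suc (length units) ≡ q
  suc-length-units = trans (length-unique-same-members
    (All.tabulate (λ x∈units 0≡x → ∈-units⁻ x∈units (sym 0≡x)) ∷ units-unique) elements-unique
    (λ _ → elements-complete _) from) card
    where
    from : ∀ {x} → x ∈ elements → x ∈ 0# ∷ units
    from {x} _ with x ≟ 0#
    ... | yes x≡0 = here x≡0
    ... | no  x≢0 = there (∈-units⁺ x≢0)

  product-map-* : ∀ x xs → product (map (x *_) xs) ≡ pow F x (length xs) * product xs
  product-map-* x []       = sym (*-identityˡ 1#)
  product-map-* x (y ∷ xs) =
    trans (cong (x * y *_) (product-map-* x xs)) (*-interchange x y (pow F x (length xs)) (product xs))

  product-nonzero : ∀ {xs} → All (_≢ 0#) xs → product xs ≢ 0#
  product-nonzero []             = λ 1≡0 → 0≢1 (sym 1≡0)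
  product-nonzero (x≢0 ∷ xs≢0) = *-nonzero x≢0 (product-nonzero xs≢0)

  -- Multiplication by x permutes the units, so x^|units| · ∏ units = ∏ units.
  pow-length-units : ∀ {x} → x ≢ 0# → pow F x (length units) ≡ 1#
  pow-length-units {x} x≢0 = *-cancelʳ (product-nonzero (All.tabulate ∈-units⁻)) (begin
    pow F x (length units) * product units ≡⟨ product-map-* x units ⟨
    product (map (x *_) units)             ≡⟨ product-↭ x*units↭units ⟩
    product units                          ≡⟨ *-identityˡ _ ⟨
    1# * product units                     ∎)
    where
    open ≡-Reasoning
    x*units↭units : map (x *_) units ↭ units
    x*units↭units = unique-same-members⇒↭ (Unique.map⁺ (*-cancelˡ x≢0) units-unique) units-unique
      (λ xy∈ → case ∈-map⁻ (x *_) xy∈ of λ { (y , y∈units , refl) → ∈-units⁺ (*-nonzero x≢0 (∈-units⁻ y∈units)) })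
      (λ {z} z∈units → subst (_∈ map (x *_) units) (x*[x⁻¹*y]≡y z x≢0)
        (∈-map⁺ (x *_) (∈-units⁺ (*-nonzero (inv-nonzero x≢0) (∈-units⁻ z∈units)))))

  rootsOfUnity : ℕ → List Carrier
  rootsOfUnity d = filter (λ x → pow F x d ≟ 1#) elements

  rootsOfUnity-unique : ∀ d → Unique (rootsOfUnity d)
  rootsOfUnity-unique d = Unique.filter⁺ (λ x → pow F x d ≟ 1#) elements-unique

  ∈-rootsOfUnity⁺ : ∀ {d x} → R F d x → x ∈ rootsOfUnity d
  ∈-rootsOfUnity⁺ {d} {x} = ∈-filter⁺ (λ x → pow F x d ≟ 1#) (elements-complete x)

  ∈-rootsOfUnity⁻ : ∀ {d x} → x ∈ rootsOfUnity d → R F d x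
  ∈-rootsOfUnity⁻ {d} x∈ = proj₂ (∈-filter⁻ (λ x → pow F x d ≟ 1#) {xs = elements} x∈)

  -- x ↦ x^m maps the m·d units into R_d with fibres of size at most m.
  length-rootsOfUnity : ∀ m d .{{_ : ℕ.NonZero m}} .{{_ : ℕ.NonZero d}} →
    q ≡ m ℕ.* d ℕ.+ 1 → length (rootsOfUnity d) ≡ d
  length-rootsOfUnity (suc m) (suc d) q≡md+1 = ℕ.≤-antisym at-most at-least
    where
    open ℕ.≤-Reasoning
    Rd = rootsOfUnity (suc d)
    fibre : Carrier → ℕ
    fibre y = length (filter (λ x → pow F x (suc m) ≟ y) units)
    length-units≡md : length units ≡ suc m ℕ.* suc d
    length-units≡md = ℕ.suc-injective (trans suc-length-units (trans q≡md+1 (ℕ.+-comm _ 1)))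
    pow-m∈Rd : All (λ x → pow F x (suc m) ∈ Rd) units
    pow-m∈Rd = All.tabulate λ {x} x∈units → ∈-rootsOfUnity⁺ {suc d} (
      trans (sym (pow-* x (suc m) (suc d)))
        (trans (cong (pow F x) (sym length-units≡md)) (pow-length-units (∈-units⁻ x∈units))))
    fibre≤m : ∀ y → fibre y ≤ suc m
    fibre≤m y = length-roots-pow≤ m y (Unique.filter⁺ _ units-unique) (All.all-filter _ units)
    at-most : length Rd ≤ suc d
    at-most = length-roots-pow≤ d 1# (rootsOfUnity-unique (suc d)) (All.all-filter _ elements)
    at-least : suc d ≤ length Rd
    at-least = ℕ.*-cancelˡ-≤ (suc m) (begin
      suc m ℕ.* suc d       ≡⟨ length-units≡md ⟨
      length units          ≡⟨ length≡sum-fibres _≟_ (λ x → pow F x (suc m)) (rootsOfUnity-unique (suc d)) units pow-m∈Rd ⟩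
      sum (map fibre Rd)    ≤⟨ sum-map-≤ fibre (suc m) fibre≤m Rd ⟩
      length Rd ℕ.* suc m   ≡⟨ ℕ.*-comm (length Rd) (suc m) ⟩
      suc m ℕ.* length Rd   ∎)

  -- Counting differences and blocks

  count≡length-filter : ∀ g xs → count F g xs ≡ length (filter (g ≟_) xs)
  count≡length-filter g []       = refl
  count≡length-filter g (x ∷ xs) with g ≟ x
  ... | yes _ = cong suc (count≡length-filter g xs)
  ... | no  _ = count≡length-filter g xs

  count-concatMap : ∀ {A : Set} g (f : A → List Carrier) xs →
    count F g (concatMap f xs) ≡ sum (map (λ x → count F g (f x)) xs)
  count-concatMap g f xs = trans (count≡length-filter g (concatMap f xs)) (trans
    (length-filter-concatMap (g ≟_) f xs)
    (cong sum (map-cong (λ x → sym (count≡length-filter g (f x))) xs)))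

  count-unique : ∀ {g xs} → Unique xs → count F g xs ≡ indicator (g ∈? xs)
  count-unique {g} {xs} uxs with g ∈? xs
  ... | yes g∈xs = trans (count≡length-filter g xs) (length-filter-≟-unique _≟_ uxs g∈xs)
  ... | no  g∉xs = trans (count≡length-filter g xs) (cong length (filter-none (g ≟_) (All.¬Any⇒All¬ xs g∉xs)))

  hasPair? : ∀ x y b → Dec (x ∈ b × y ∈ b)
  hasPair? x y b = (x ∈? b) ×-dec (y ∈? b)

  countBlocks≡length-filter : ∀ x y ℬ → countBlocks F x y ℬ ≡ length (filter (hasPair? x y) ℬ)
  countBlocks≡length-filter x y []      = refl
  countBlocks≡length-filter x y (b ∷ ℬ) with x ∈? b | y ∈? b
  ... | yes _ | yes _ = cong suc (countBlocks≡length-filter x y ℬ)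
  ... | yes _ | no  _ = countBlocks≡length-filter x y ℬ
  ... | no  _ | yes _ = countBlocks≡length-filter x y ℬ
  ... | no  _ | no  _ = countBlocks≡length-filter x y ℬ

  countBlocks-++ : ∀ x y ℬ 𝒞 → countBlocks F x y (ℬ ++ 𝒞) ≡ countBlocks F x y ℬ ℕ.+ countBlocks F x y 𝒞
  countBlocks-++ x y ℬ 𝒞 = begin
    countBlocks F x y (ℬ ++ 𝒞)                                       ≡⟨ countBlocks≡length-filter x y (ℬ ++ 𝒞) ⟩
    length (filter (hasPair? x y) (ℬ ++ 𝒞))                          ≡⟨ cong length (filter-++ (hasPair? x y) ℬ 𝒞) ⟩
    length (filter (hasPair? x y) ℬ ++ filter (hasPair? x y) 𝒞)      ≡⟨ length-++ (filter (hasPair? x y) ℬ) ⟩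
    length (filter (hasPair? x y) ℬ) ℕ.+ length (filter (hasPair? x y) 𝒞)
      ≡⟨ cong₂ ℕ._+_ (countBlocks≡length-filter x y ℬ) (countBlocks≡length-filter x y 𝒞) ⟨
    countBlocks F x y ℬ ℕ.+ countBlocks F x y 𝒞 ∎
    where open ≡-Reasoning

  countBlocks-concatMap : ∀ {A : Set} x y (f : A → List (List Carrier)) xs →
    countBlocks F x y (concatMap f xs) ≡ sum (map (λ a → countBlocks F x y (f a)) xs)
  countBlocks-concatMap x y f xs = trans (countBlocks≡length-filter x y (concatMap f xs)) (trans
    (length-filter-concatMap (hasPair? x y) f xs)
    (cong sum (map-cong (λ a → sym (countBlocks≡length-filter x y (f a))) xs)))

  sumF-zero-if-invariant : ∀ {h xs} → h ≢ 1# → map (h *_) xs ↭ xs → sumF F xs ≡ 0#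
  sumF-zero-if-invariant {h} {xs} h≢1 hxs↭xs = decidable-stable (sumF F xs ≟ 0#) λ Σ≢0 →
    h≢1 (*-cancelʳ Σ≢0 (begin
      h * sumF F xs           ≡⟨ sumF-map-* h xs ⟨
      sumF F (map (h *_) xs)  ≡⟨ sumF-↭ hxs↭xs ⟩
      sumF F xs               ≡⟨ *-identityˡ _ ⟨
      1# * sumF F xs          ∎))
    where open ≡-Reasoning

  -- The quotient list of a single ordered pair, local to ΔBlock, recovered by unification.
  private
    pairQuotient : List Carrier → Carrier → Carrier → List Carrier
    pairQuotient b = local refl
      where
      local : ∀ {D} → ΔBlock F b ≡ concatMap (λ x → concatMap (D x) b) b → Carrier → Carrier → List Carrier
      local {D} _ = D

  count-pairQuotient : ∀ {g} b {a c} → g ≢ 0# → g ≢ 1# → a ≢ 0# → c ≢ 0# →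
    count F g (pairQuotient b a c) ≡ count F (a * inv g) (c ∷ [])
  count-pairQuotient {g} b {a} {c} g≢0 g≢1 a≢0 c≢0 with a ≟ c
  ... | yes refl with (a * inv g) ≟ a
  ...   | yes ag⁻¹≡a = contradiction (trans (sym (≡*inv⇒*inv≡ a≢0 g≢0 (sym ag⁻¹≡a))) (*-inv a a≢0)) g≢1
  ...   | no  _      = refl
  count-pairQuotient {g} b {a} {c} g≢0 g≢1 a≢0 c≢0 | no _ with g ≟ (a * inv c) | (a * inv g) ≟ c
  ... | yes g≡ac⁻¹ | yes _      = refl
  ... | no  _      | no  _      = refl
  ... | yes g≡ac⁻¹ | no  ag⁻¹≢c = contradiction (≡*inv⇒*inv≡ a≢0 c≢0 g≡ac⁻¹) ag⁻¹≢c
  ... | no  g≢ac⁻¹ | yes ag⁻¹≡c = contradiction (sym (≡*inv⇒*inv≡ a≢0 g≢0 (sym ag⁻¹≡c))) g≢ac⁻¹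

  -- g = a·c⁻¹ with a, c ∈ b determines c = a·g⁻¹.
  count-ΔBlock : ∀ {g} b → Unique b → All (_≢ 0#) b → g ≢ 0# → g ≢ 1# →
    count F g (ΔBlock F b) ≡ length (filter (λ a → a * inv g ∈? b) b)
  count-ΔBlock {g} b ub b≢0 g≢0 g≢1 = begin
    count F g (concatMap (λ a → concatMap (pairQuotient b a) b) b)  ≡⟨ count-concatMap g _ b ⟩
    sum (map (λ a → count F g (concatMap (pairQuotient b a) b)) b)  ≡⟨ cong sum (map-cong-local (All.map row b≢0)) ⟩
    sum (map (λ a → indicator (a * inv g ∈? b)) b)                  ≡⟨ length-filter≡sum (λ a → a * inv g ∈? b) b ⟨
    length (filter (λ a → a * inv g ∈? b) b)                        ∎
    where
    open ≡-Reasoning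
    row : ∀ {a} → a ≢ 0# → count F g (concatMap (pairQuotient b a) b) ≡ indicator (a * inv g ∈? b)
    row {a} a≢0 = begin
      count F g (concatMap (pairQuotient b a) b)           ≡⟨ count-concatMap g _ b ⟩
      sum (map (λ c → count F g (pairQuotient b a c)) b)
        ≡⟨ cong sum (map-cong-local (All.map (count-pairQuotient b g≢0 g≢1 a≢0) b≢0)) ⟩
      sum (map (λ c → count F (a * inv g) (c ∷ [])) b)     ≡⟨ count-concatMap (a * inv g) (_∷ []) b ⟨
      count F (a * inv g) (concatMap (_∷ []) b)            ≡⟨ cong (count F (a * inv g)) (concatMap-pure b) ⟩
      count F (a * inv g) b                                ≡⟨ count-unique ub ⟩
      indicator (a * inv g ∈? b)                           ∎

  -- Developments of base blocks and cosets of R_k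

  module Development (v : ℕ) .{{_ : ℕ.NonZero v}} where

    development : List Carrier → List (List Carrier)
    development b = map (λ r → map (r *_) b) (rootsOfUnity v)

    development-kSubsets : ∀ {k b} → IsKSubsetOf F (R F v) k b →
      All (IsKSubsetOf F (_∈ rootsOfUnity v) k) (development b)
    development-kSubsets {k} {b} (length-b , ub , b⊆R) = All.map⁺ (All.tabulate λ {r} r∈R →
      let R-r = ∈-rootsOfUnity⁻ {v} r∈R in
      trans (length-map (r *_) b) length-b ,
      Unique.map⁺ (*-cancelˡ (R⇒nonzero {v} R-r)) ub ,
      All.map⁺ (All.map (λ R-a → ∈-rootsOfUnity⁺ {v} (R-* {v} R-r R-a)) b⊆R))

    development-zeroSum : ∀ {b} → ZeroSum F b → All (ZeroSum F) (development b)
    development-zeroSum {b} Σb≡0 = All.map⁺ (All.tabulate λ {r} _ →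
      trans (sumF-map-* r b) (trans (cong (r *_) Σb≡0) (zeroʳ r)))

    -- a ↦ x·a⁻¹ is a bijection from {a ∈ b | a·y·x⁻¹ ∈ b} onto {r ∈ R_v | x, y ∈ r·b}.
    length-translates-containing : ∀ {b x y} → Unique b → All (R F v) b → R F v x → R F v y →
      length (filter (λ a → (a * (y * inv x)) ∈? b) b) ≡
      length (filter (λ r → hasPair? x y (map (r *_) b)) (rootsOfUnity v))
    length-translates-containing {b} {x} {y} ub b⊆R R-x R-y =
      length-injective-image (λ a → x * inv a) (λ eq → inv-injective (*-cancelˡ x≢0 eq))
        (Unique.filter⁺ _ ub) (Unique.filter⁺ _ (rootsOfUnity-unique v)) image⊆ ⊆image
      where
      w = y * inv x
      x≢0 = R⇒nonzero {v} R-x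
      image⊆ : ∀ {r} → r ∈ map (λ a → x * inv a) (filter (λ a → (a * w) ∈? b) b) →
        r ∈ filter (λ r → hasPair? x y (map (r *_) b)) (rootsOfUnity v)
      image⊆ r∈ with ∈-map⁻ _ r∈
      ... | a , a∈ , refl with ∈-filter⁻ (λ a → (a * w) ∈? b) {xs = b} a∈
      ...   | a∈b , aw∈b = ∈-filter⁺ (λ r → hasPair? x y (map (r *_) b))
        (∈-rootsOfUnity⁺ {v} (R-* {v} R-x (R-inv {v} a≢0 (All.lookup b⊆R a∈b))))
        ( subst (_∈ map (x * inv a *_) b) (x*y⁻¹*y≡x x a≢0) (∈-map⁺ _ a∈b)
        , subst (_∈ map (x * inv a *_) b) maps-to-y (∈-map⁺ _ aw∈b))
        where
        a≢0 = R⇒nonzero {v} (All.lookup b⊆R a∈b)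
        maps-to-y : x * inv a * (a * w) ≡ y
        maps-to-y = trans (sym (*-assoc (x * inv a) a w)) (trans (cong (_* w) (x*y⁻¹*y≡x x a≢0)) (x*[y*x⁻¹]≡y y x≢0))
      ⊆image : ∀ {r} → r ∈ filter (λ r → hasPair? x y (map (r *_) b)) (rootsOfUnity v) →
        r ∈ map (λ a → x * inv a) (filter (λ a → (a * w) ∈? b) b)
      ⊆image {r} r∈ with ∈-filter⁻ (λ r → hasPair? x y (map (r *_) b)) {xs = rootsOfUnity v} r∈
      ... | r∈R , x∈rb , y∈rb with ∈-map⁻ (r *_) x∈rb | ∈-map⁻ (r *_) y∈rb
      ...   | a , a∈b , refl | c , c∈b , refl =
        subst (_∈ map (λ a′ → r * a * inv a′) (filter (λ a → (a * w) ∈? b) b)) (x*y*y⁻¹≡x r a≢0)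
          (∈-map⁺ _ (∈-filter⁺ (λ a → (a * w) ∈? b) a∈b (subst (_∈ b) (sym maps-to-c) c∈b)))
        where
        open ≡-Reasoning
        r≢0 = R⇒nonzero {v} (∈-rootsOfUnity⁻ {v} r∈R)
        a≢0 = R⇒nonzero {v} (All.lookup b⊆R a∈b)
        maps-to-c : a * (r * c * inv (r * a)) ≡ c
        maps-to-c = begin
          a * (r * c * inv (r * a))         ≡⟨ cong (λ z → a * (r * c * z)) (inv-distrib-* r≢0 a≢0) ⟩
          a * (r * c * (inv r * inv a))     ≡⟨ cong (a *_) (*-interchange r c (inv r) (inv a)) ⟩
          a * (r * inv r * (c * inv a))     ≡⟨ cong (λ z → a * (z * (c * inv a))) (*-inv r r≢0) ⟩
          a * (1# * (c * inv a))            ≡⟨ cong (a *_) (*-identityˡ (c * inv a)) ⟩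
          a * (c * inv a)                   ≡⟨ x*[y*x⁻¹]≡y c a≢0 ⟩
          c                                 ∎

    countBlocks-development : ∀ {b x y} → Unique b → All (R F v) b → R F v x → R F v y → x ≢ y →
      countBlocks F x y (development b) ≡ count F (x * inv y) (ΔBlock F b)
    countBlocks-development {b} {x} {y} ub b⊆R R-x R-y x≢y = begin
      countBlocks F x y (development b)
        ≡⟨ countBlocks≡length-filter x y (development b) ⟩
      length (filter (hasPair? x y) (development b))
        ≡⟨ length-filter-map (hasPair? x y) (λ r → map (r *_) b) (rootsOfUnity v) ⟩
      length (filter (λ r → hasPair? x y (map (r *_) b)) (rootsOfUnity v))
        ≡⟨ length-translates-containing ub b⊆R R-x R-y ⟨
      length (filter (λ a → (a * (y * inv x)) ∈? b) b)
        ≡⟨ cong (λ w → length (filter (λ a → (a * w) ∈? b) b)) (inv-*-inv x≢0 y≢0) ⟨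
      length (filter (λ a → (a * inv g) ∈? b) b)
        ≡⟨ count-ΔBlock b ub (All.map (R⇒nonzero {v}) b⊆R) g≢0 g≢1 ⟨
      count F g (ΔBlock F b) ∎
      where
      open ≡-Reasoning
      g = x * inv y
      x≢0 = R⇒nonzero {v} R-x
      y≢0 = R⇒nonzero {v} R-y
      g≢0 : g ≢ 0#
      g≢0 = *-nonzero x≢0 (inv-nonzero y≢0)
      g≢1 : g ≢ 1#
      g≢1 g≡1 = x≢y (sym (inv-injective (*≡1⇒≡inv g≡1)))

    countBlocks-developments : ∀ {k ℱ x y} → All (IsKSubsetOf F (R F v) k) ℱ → R F v x → R F v y → x ≢ y →
      countBlocks F x y (concatMap development ℱ) ≡ count F (x * inv y) (Δ F ℱ)
    countBlocks-developments {ℱ = ℱ} {x} {y} ℱ-ok R-x R-y x≢y = begin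
      countBlocks F x y (concatMap development ℱ)
        ≡⟨ countBlocks-concatMap x y development ℱ ⟩
      sum (map (λ b → countBlocks F x y (development b)) ℱ)
        ≡⟨ cong sum (map-cong-local (All.map (λ (_ , ub , b⊆R) → countBlocks-development ub b⊆R R-x R-y x≢y) ℱ-ok)) ⟩
      sum (map (λ b → count F (x * inv y) (ΔBlock F b)) ℱ)
        ≡⟨ count-concatMap (x * inv y) (ΔBlock F) ℱ ⟨
      count F (x * inv y) (Δ F ℱ) ∎
      where open ≡-Reasoning

  module Cosets (v k s : ℕ) .{{_ : ℕ.NonZero v}} .{{_ : ℕ.NonZero k}} (v≡sk : v ≡ s ℕ.* k)
                (length-R-k : length (rootsOfUnity k) ≡ k) (2≤k : 2 ≤ k) where

    R-k⇒R-v : ∀ {x} → R F k x → R F v x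
    R-k⇒R-v {x} R-x = subst (λ n → R F n x) (sym (trans v≡sk (ℕ.*-comm s k))) (R-divisor {k} {s} R-x)

    inCoset? : (c x : Carrier) → Dec (R F v x × pow F x k ≡ c)
    inCoset? c x = (pow F x v ≟ 1#) ×-dec (pow F x k ≟ c)

    coset : Carrier → List Carrier
    coset c = filter (inCoset? c) elements

    -- The cosets of R_k in R_v are the fibres of x ↦ x^k on R_v, labelled by that value.
    labels : List Carrier
    labels = filter (_∈? map (λ x → pow F x k) (rootsOfUnity v)) elements

    cosets : List (List Carrier)
    cosets = map coset labels

    coset-unique : ∀ c → Unique (coset c)
    coset-unique c = Unique.filter⁺ (inCoset? c) elements-unique

    ∈-coset⁺ : ∀ {c x} → R F v x → pow F x k ≡ c → x ∈ coset c
    ∈-coset⁺ {c} {x} R-x xᵏ≡c = ∈-filter⁺ (inCoset? c) (elements-complete x) (R-x , xᵏ≡c)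

    ∈-coset⁻ : ∀ {c x} → x ∈ coset c → R F v x × pow F x k ≡ c
    ∈-coset⁻ {c} x∈ = proj₂ (∈-filter⁻ (inCoset? c) {xs = elements} x∈)

    *-∈-coset : ∀ {c h x} → R F k h → x ∈ coset c → h * x ∈ coset c
    *-∈-coset {c} {h} {x} R-h x∈ with ∈-coset⁻ x∈
    ... | R-x , xᵏ≡c = ∈-coset⁺ (R-* {v} (R-k⇒R-v R-h) R-x)
      (trans (pow-distrib-* h x k) (trans (cong₂ _*_ R-h xᵏ≡c) (*-identityˡ c)))

    -- The coset of x₀ is R_k · x₀.
    length-coset : ∀ {c} → c ∈ labels → length (coset c) ≡ k
    length-coset {c} c∈
      with ∈-map⁻ (λ x → pow F x k) (proj₂ (∈-filter⁻ (_∈? map (λ x → pow F x k) (rootsOfUnity v)) {xs = elements} c∈))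
    ... | x₀ , x₀∈R , refl = trans (sym (length-injective-image (_* x₀) (*-cancelʳ x₀≢0)
          (rootsOfUnity-unique k) (coset-unique (pow F x₀ k)) image⊆ ⊆image)) length-R-k
      where
      R-x₀ = ∈-rootsOfUnity⁻ {v} x₀∈R
      x₀≢0 = R⇒nonzero {v} R-x₀
      image⊆ : ∀ {z} → z ∈ map (_* x₀) (rootsOfUnity k) → z ∈ coset (pow F x₀ k)
      image⊆ z∈ with ∈-map⁻ (_* x₀) z∈
      ... | h , h∈R , refl = *-∈-coset (∈-rootsOfUnity⁻ {k} h∈R) (∈-coset⁺ R-x₀ refl)
      ⊆image : ∀ {z} → z ∈ coset (pow F x₀ k) → z ∈ map (_* x₀) (rootsOfUnity k)
      ⊆image {z} z∈ = subst (_∈ map (_* x₀) (rootsOfUnity k)) (x*y⁻¹*y≡x z x₀≢0)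
        (∈-map⁺ (_* x₀) (∈-rootsOfUnity⁺ {k} (pow≡⇒R-*inv k x₀≢0 (proj₂ (∈-coset⁻ z∈)))))

    -- Multiplication by any h ∈ R_k other than 1 permutes each coset.
    coset-zeroSum : ∀ c → ZeroSum F (coset c)
    coset-zeroSum c with ∃-≢ _≟_ (rootsOfUnity-unique k) (subst (2 ≤_) (sym length-R-k) 2≤k) 1#
    ... | h , h∈R , h≢1 = sumF-zero-if-invariant h≢1 (unique-same-members⇒↭
          (Unique.map⁺ (*-cancelˡ h≢0) (coset-unique c)) (coset-unique c) image⊆ ⊆image)
      where
      R-h = ∈-rootsOfUnity⁻ {k} h∈R
      h≢0 = R⇒nonzero {k} R-h
      image⊆ : ∀ {z} → z ∈ map (h *_) (coset c) → z ∈ coset c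
      image⊆ z∈ with ∈-map⁻ (h *_) z∈
      ... | x , x∈ , refl = *-∈-coset R-h x∈
      ⊆image : ∀ {z} → z ∈ coset c → z ∈ map (h *_) (coset c)
      ⊆image {z} z∈ = subst (_∈ map (h *_) (coset c)) (x*[x⁻¹*y]≡y z h≢0)
        (∈-map⁺ (h *_) (*-∈-coset (R-inv {k} h≢0 R-h) z∈))

    cosets-kSubsets : All (IsKSubsetOf F (_∈ rootsOfUnity v) k) cosets
    cosets-kSubsets = All.map⁺ (All.tabulate λ {c} c∈ →
      length-coset c∈ , coset-unique c , All.tabulate (λ x∈ → ∈-rootsOfUnity⁺ {v} (proj₁ (∈-coset⁻ x∈))))

    cosets-zeroSum : All (ZeroSum F) cosets
    cosets-zeroSum = All.map⁺ (All.tabulate λ {c} _ → coset-zeroSum c)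

    countBlocks-cosets : ∀ {x y} → R F v x → R F v y →
      countBlocks F x y cosets ≡ indicator (pow F x k ≟ pow F y k)
    countBlocks-cosets {x} {y} R-x R-y = begin
      countBlocks F x y cosets                                     ≡⟨ countBlocks≡length-filter x y cosets ⟩
      length (filter (hasPair? x y) cosets)                        ≡⟨ length-filter-map (hasPair? x y) coset labels ⟩
      length (filter (λ c → hasPair? x y (coset c)) labels)        ≡⟨ cong length (filter-≐ _ both? same-labels labels) ⟩
      length (filter both? labels)                                 ≡⟨ answer ⟩
      indicator (pow F x k ≟ pow F y k)                            ∎
      where
      open ≡-Reasoning
      both? : (c : Carrier) → Dec (pow F x k ≡ c × pow F y k ≡ c)
      both? c = (pow F x k ≟ c) ×-dec (pow F y k ≟ c)
      same-labels : (λ c → x ∈ coset c × y ∈ coset c) ≐ (λ c → pow F x k ≡ c × pow F y k ≡ c)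
      same-labels = (λ (x∈ , y∈) → proj₂ (∈-coset⁻ x∈) , proj₂ (∈-coset⁻ y∈))
                  , (λ (xᵏ≡c , yᵏ≡c) → ∈-coset⁺ R-x xᵏ≡c , ∈-coset⁺ R-y yᵏ≡c)
      answer : length (filter both? labels) ≡ indicator (pow F x k ≟ pow F y k)
      answer with pow F x k ≟ pow F y k
      ... | yes xᵏ≡yᵏ = trans
        (cong length (filter-≐ both? (pow F x k ≟_) (proj₁ , λ xᵏ≡c → xᵏ≡c , trans (sym xᵏ≡yᵏ) xᵏ≡c) labels))
        (length-filter-≟-unique _≟_ (Unique.filter⁺ _ elements-unique)
          (∈-filter⁺ _ (elements-complete _) (∈-map⁺ _ (∈-rootsOfUnity⁺ {v} R-x))))
      ... | no  xᵏ≢yᵏ = cong length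
        (filter-none both? {labels} (All.tabulate λ _ (xᵏ≡c , yᵏ≡c) → xᵏ≢yᵏ (trans xᵏ≡c (sym yᵏ≡c))))

  -- The design on R_v

  rootsOfUnity-design : ∀ n v k .{{_ : ℕ.NonZero n}} .{{_ : ℕ.NonZero v}} {ℬ} →
    q ≡ n ℕ.* v ℕ.+ 1 → 2 < k → k < v → All (IsKSubsetOf F (_∈ rootsOfUnity v) k) ℬ →
    (∀ {x y} → R F v x → R F v y → x ≢ y → countBlocks F x y ℬ ≡ 1) →
    IsDesign F v k (rootsOfUnity v) ℬ
  rootsOfUnity-design n v k q≡nv+1 2<k k<v ℬ-ok covers-pairs =
    2<k , k<v , length-rootsOfUnity n v q≡nv+1 , rootsOfUnity-unique v , ℬ-ok ,
    λ x y x∈R y∈R → covers-pairs (∈-rootsOfUnity⁻ {v} x∈R) (∈-rootsOfUnity⁻ {v} y∈R)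

  module _ (n v k : ℕ) .{{_ : ℕ.NonZero n}} .{{_ : ℕ.NonZero v}} (q≡nv+1 : q ≡ n ℕ.* v ℕ.+ 1)
           (2<k : 2 < k) (k<v : k < v) {ℱ : List (List Carrier)}
           (ℱ-kSubsets : All (IsKSubsetOf F (R F v) k) ℱ) (ℱ-zeroSum : All (ZeroSum F) ℱ) where

    open Development v

    R-*inv : ∀ {x y} → R F v x → R F v y → R F v (x * inv y)
    R-*inv R-x R-y = R-* {v} R-x (R-inv {v} (R⇒nonzero {v} R-y) R-y)

    developments-kSubsets : All (IsKSubsetOf F (_∈ rootsOfUnity v) k) (concatMap development ℱ)
    developments-kSubsets = All.concat⁺ (All.map⁺ (All.map development-kSubsets ℱ-kSubsets))

    developments-zeroSum : All (ZeroSum F) (concatMap development ℱ)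
    developments-zeroSum = All.concat⁺ (All.map⁺ (All.map development-zeroSum ℱ-zeroSum))

    additiveDesign-development : IsDF F (R F v) (_≡ 1#) k ℱ → AdditiveDesign F v k
    additiveDesign-development (_ , Δℱ) =
      rootsOfUnity v , concatMap development ℱ ,
      rootsOfUnity-design n v k q≡nv+1 2<k k<v developments-kSubsets covers-pairs , developments-zeroSum
      where
      covers-pairs : ∀ {x y} → R F v x → R F v y → x ≢ y → countBlocks F x y (concatMap development ℱ) ≡ 1
      covers-pairs {x} {y} R-x R-y x≢y = trans (countBlocks-developments ℱ-kSubsets R-x R-y x≢y)
        (proj₁ (Δℱ (x * inv y)) (R-*inv R-x R-y , λ xy⁻¹≡1 → x≢y (sym (inv-injective (*≡1⇒≡inv xy⁻¹≡1)))))

    -- The differences missing from Δℱ, those in R_k, are supplied by the cosets of R_k.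
    additiveDesign-development+cosets : ∀ s .{{_ : ℕ.NonZero s}} → v ≡ s ℕ.* k →
      IsDF F (R F v) (λ x → R F v x × R F k x) k ℱ → AdditiveDesign F v k
    additiveDesign-development+cosets s v≡sk (_ , Δℱ) =
      rootsOfUnity v , concatMap development ℱ ++ cosets ,
      rootsOfUnity-design n v k q≡nv+1 2<k k<v (All.++⁺ developments-kSubsets cosets-kSubsets) covers-pairs ,
      All.++⁺ developments-zeroSum cosets-zeroSum
      where
      instance
        k≢0 : ℕ.NonZero k
        k≢0 = ℕ.>-nonZero (ℕ.<-trans (s≤s z≤n) 2<k)
      q≡[ns]k+1 : q ≡ n ℕ.* s ℕ.* k ℕ.+ 1
      q≡[ns]k+1 = trans q≡nv+1 (cong (ℕ._+ 1) (trans (cong (n ℕ.*_) v≡sk) (sym (ℕ.*-assoc n s k))))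
      open Cosets v k s v≡sk (length-rootsOfUnity (n ℕ.* s) k {{ℕ.m*n≢0 n s}} q≡[ns]k+1) (ℕ.<⇒≤ 2<k)
      covers-pairs : ∀ {x y} → R F v x → R F v y → x ≢ y → countBlocks F x y (concatMap development ℱ ++ cosets) ≡ 1
      covers-pairs {x} {y} R-x R-y x≢y = begin
        countBlocks F x y (concatMap development ℱ ++ cosets)
          ≡⟨ countBlocks-++ x y (concatMap development ℱ) cosets ⟩
        countBlocks F x y (concatMap development ℱ) ℕ.+ countBlocks F x y cosets
          ≡⟨ cong₂ ℕ._+_ (countBlocks-developments ℱ-kSubsets R-x R-y x≢y) (countBlocks-cosets R-x R-y) ⟩
        count F (x * inv y) (Δ F ℱ) ℕ.+ indicator (pow F x k ≟ pow F y k)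
          ≡⟨ in-R-k-or-not ⟩
        1 ∎
        where
        open ≡-Reasoning
        y≢0 = R⇒nonzero {v} R-y
        in-R-k-or-not : count F (x * inv y) (Δ F ℱ) ℕ.+ indicator (pow F x k ≟ pow F y k) ≡ 1
        in-R-k-or-not with pow F x k ≟ pow F y k
        ... | yes xᵏ≡yᵏ = cong (ℕ._+ 1)
                            (proj₂ (Δℱ (x * inv y)) λ (_ , ∉H) → ∉H (R-*inv R-x R-y , pow≡⇒R-*inv k y≢0 xᵏ≡yᵏ))
        ... | no  xᵏ≢yᵏ = trans (ℕ.+-identityʳ _) (proj₁ (Δℱ (x * inv y))
                            (R-*inv R-x R-y , λ (_ , R-k) → xᵏ≢yᵏ (R-*inv⇒pow≡ k y≢0 R-k)))

-- Imported only here: inside the module above these names are the field operations.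
open import Data.Nat using (_+_; _*_)

theorem2p3 : (n v k : ℕ) → 0 < n → 0 < v → 2 < k → k < v →
    (F : FiniteField (n * v + 1)) →
    Σ (List (List (FiniteField.Carrier F))) (λ ℱ → IsCyclicDF F v k ℱ × All (ZeroSum F) ℱ) →
    AdditiveDesign F v k
theorem2p3 n@(suc _) v@(suc _) k _ _ 2<k k<v F (ℱ , inj₁ (_ , ℱ-DF) , ℱ-zeroSum) =
  additiveDesign-development F n v k refl 2<k k<v (proj₁ ℱ-DF) ℱ-zeroSum ℱ-DF
theorem2p3 n@(suc _) v@(suc _) k@(suc k′) _ _ 2<k k<v F (ℱ , inj₂ ((t , v≡k+t·k[k-1]) , ℱ-DF) , ℱ-zeroSum) =
  additiveDesign-development+cosets F n v k refl 2<k k<v (proj₁ ℱ-DF) ℱ-zeroSum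
    (suc (t * k′)) (trans v≡k+t·k[k-1] (factor k′ t)) ℱ-DF
  where
  factor : ∀ k′ t → suc k′ + t * (suc k′ * k′) ≡ suc (t * k′) * suc k′
  factor = ℕ-Solver.solve-∀
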